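{- Under the Modified CFLS coloring $\varphi$ of $K_n$ ($n=2^{m^2}$), there is no copy of $K_5$ which is a 2-2-2-2-2 coloring in which one color class is a matching and the other four are paths.
   Context: Let $m$ be a positive integer and $n=2^{m^2}$. The vertices of $K_n$ are the binary strings $v\in\{0,1\}^{m^2}$, written as $v=(v^{(1)},\dots,v^{(m)})$ with each block $v^{(k)}\in\{0,1\}^m$. Vertices (and blocks) are linearly ordered as binary integers: $x<y$ iff at the first bit where they differ, $x$ has 0 and $y$ has 1. For $x<y$, let $i$ be the first index with $x^{(i)}\ne y^{(i)}$; for $k\in[m]$ let $i_k$ be the first position at which the bits of $x^{(k)}$ and $y^{(k)}$ differ ($i_k=0$ if $x^{(k)}=y^{(k)}$), and let $\delta_k=+1$ if $x^{(k)}\le y^{(k)}$ and $\delta_k=-1$ if $x^{(k)}>y^{(k)}$. The Modified CFLS coloring assigns to edge $xy$ the color $\varphi(xy)=((i,\{x^{(i)},y^{(i)}\}),i_1,\dots,i_m,\delta_1,\dots,\delta_m)$. A copy of $K_5$ is a 2-2-2-2-2 coloring if its ten edges receive exactly five colors, each on exactly two edges; each color class is then either a matching (two disjoint edges) or a path of length 2 (two edges sharing a vertex). -}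

module Defs where

open import Data.Bool using (Bool; true; false; not; if_then_else_; _∧_)
open import Data.Nat using (ℕ; zero; suc)
open import Data.Fin using (Fin; _<_)
open import Data.Vec using (Vec; []; _∷_; concat; zipWith)
open import Data.Maybe using (Maybe; just; nothing)
open import Data.Product using (_×_; _,_; Σ; ∃-syntax)
open import Data.Sum using (_⊎_)
open import Relation.Binary.PropositionalEquality using (_≡_; _≢_)

Block : ℕ → Set
Block m = Vec Bool m

Vertex : ℕ → Set
Vertex m = Vec (Block m) m

ltBits : ∀ {n} → Vec Bool n → Vec Bool n → Bool
ltBits [] [] = false
ltBits (false ∷ xs) (false ∷ ys) = ltBits xs ys
ltBits (true ∷ xs) (true ∷ ys) = ltBits xs ys
ltBits (false ∷ xs) (true ∷ ys) = true
ltBits (true ∷ xs) (false ∷ ys) = false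

ltV : ∀ {m} → Vertex m → Vertex m → Bool
ltV x y = ltBits (concat x) (concat y)

eqBit : Bool → Bool → Bool
eqBit false false = true
eqBit true true = true
eqBit _ _ = false

-- First (1-based) position where two bit strings differ; 0 if equal.
firstDiffPos : ∀ {n} → Vec Bool n → Vec Bool n → ℕ
firstDiffPos [] [] = 0
firstDiffPos (b ∷ xs) (c ∷ ys) with eqBit b c
... | false = 1
... | true with firstDiffPos xs ys
...   | zero = zero
...   | suc k = suc (suc k)

eqBlock : ∀ {n} → Vec Bool n → Vec Bool n → Bool
eqBlock [] [] = true
eqBlock (b ∷ xs) (c ∷ ys) = eqBit b c ∧ eqBlock xs ys

firstDiffBlock : ∀ {k m} → Vec (Block m) k → Vec (Block m) k → Maybe (ℕ × Block m × Block m)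
firstDiffBlock [] [] = nothing
firstDiffBlock (a ∷ xs) (b ∷ ys) with eqBlock a b
... | false = just (1 , a , b)
... | true with firstDiffBlock xs ys
...   | nothing = nothing
...   | just (i , c , d) = just (suc i , c , d)

-- The unordered pair {a, b} represented canonically as (min, max).
unordered : ∀ {m} → Block m → Block m → Block m × Block m
unordered a b = if ltBits b a then (b , a) else (a , b)

-- Colors: ((i, {x^(i), y^(i)}), i_1..i_m, δ_1..δ_m), δ_k = true encodes +1.
Color : ℕ → Set
Color m = Maybe (ℕ × (Block m × Block m)) × Vec ℕ m × Vec Bool m

mapPair : ∀ {m} → Maybe (ℕ × Block m × Block m) → Maybe (ℕ × (Block m × Block m))
mapPair nothing = nothing
mapPair (just (i , a , b)) = just (i , unordered a b)

φ< : ∀ {m} → Vertex m → Vertex m → Color m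
φ< x y = mapPair (firstDiffBlock x y)
       , zipWith firstDiffPos x y
       , zipWith (λ a b → not (ltBits b a)) x y

φ : ∀ {m} → Vertex m → Vertex m → Color m
φ x y = if ltV x y then φ< x y else φ< y x

-- Edges of K5 on vertex set Fin 5: pairs (a , b) with a < b.
-- An edge coloring of K5 is given by c a b for a < b.

-- Every color class has exactly two edges (hence, 10 edges, exactly five colors).
Is22222 : ∀ {C : Set} → (Fin 5 → Fin 5 → C) → Set
Is22222 {C} c =
  ∀ a b → a < b →
    ∃[ a' ] ∃[ b' ] (a' < b' × (a' , b') ≢ (a , b) × c a' b' ≡ c a b ×
      (∀ a'' b'' → a'' < b'' → c a'' b'' ≡ c a b →
         (a'' , b'') ≡ (a , b) ⊎ (a'' , b'') ≡ (a' , b')))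

Disjoint : Fin 5 → Fin 5 → Fin 5 → Fin 5 → Set
Disjoint a b a' b' = a ≢ a' × a ≢ b' × b ≢ a' × b ≢ b'

Share : Fin 5 → Fin 5 → Fin 5 → Fin 5 → Set
Share a b a' b' = a ≡ a' ⊎ a ≡ b' ⊎ b ≡ a' ⊎ b ≡ b'

OneMatchingFourPaths : ∀ {C : Set} → (Fin 5 → Fin 5 → C) → Set
OneMatchingFourPaths {C} c =
  Is22222 c ×
  ∃[ a ] ∃[ b ] ∃[ a' ] ∃[ b' ]
    (a < b × a' < b' × c a b ≡ c a' b' × Disjoint a b a' b' ×
     (∀ e₁ e₂ f₁ f₂ → e₁ < e₂ → f₁ < f₂ → (e₁ , e₂) ≢ (f₁ , f₂) →
        c e₁ e₂ ≡ c f₁ f₂ → c e₁ e₂ ≢ c a b → Share e₁ e₂ f₁ f₂))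

{-# OPTIONS --safe #-}
-- Fix a block index k and call x, y agreeing if x^(k) = y^(k). Since i_k = 0 exactly for
-- agreeing pairs, edges of equal colour are agreeing or not together. If ab, a′b′ is the
-- matching class, the common entry (i, {x^(i), y^(i)}) of their colour gives a block k in
-- which a, b disagree while a′, b′ agree with a, b in some order. For an agreeing edge xy,
-- its colour partner is not in the matching class, hence shares a vertex with xy, so the
-- agreement class of x has a third vertex. The two crossing agreeing edges between {a, b}
-- and {a′, b′} would need the same third vertex (the fifth vertex of K₅), making a and b agree.
module Submission where

open import Defs
open import Data.Bool using (Bool; true; false)
open import Data.Empty using (⊥; ⊥-elim)
open import Data.Fin using (Fin; zero; suc; toℕ; _<_; _≟_)
open import Data.Fin.Properties using (toℕ-injective; <-cmp; <-trans; <⇒≢; <⇒notInjective)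
open import Data.Maybe using (Maybe; just; nothing)
open import Data.Maybe.Properties using (just-injective)
open import Data.Nat as ℕ using (ℕ; _≥_)
open import Data.Nat.Properties using (suc-injective; n<1+n)
open import Data.Product using (_×_; _,_; proj₁; proj₂; ∃-syntax)
open import Data.Product.Properties using (,-injective)
open import Data.Sum as Sum using (_⊎_; inj₁; inj₂; swap)
open import Data.Vec using (Vec; []; _∷_; lookup)
open import Data.Vec.Properties using (∷-injective; lookup-zipWith)
import Data.Vec.Functional as Fun
open import Function using (_∘_)
open import Function.Bundles using (_⇔_; mk⇔; Equivalence)
open import Function.Definitions using (Injective)
open import Relation.Binary.Definitions using (tri<; tri≈; tri>)
open import Relation.Binary.PropositionalEquality using (_≡_; _≢_; refl; sym; trans; cong; cong₂)
open import Relation.Nullary using (¬_; yes; no; contradiction)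
open import Relation.Nullary.Reflects using (Reflects; ofʸ; ofⁿ; _×-reflects_)

map-reflects : ∀ {A B : Set} {b} → (A → B) → (B → A) → Reflects A b → Reflects B b
map-reflects to from (ofʸ a) = ofʸ (to a)
map-reflects to from (ofⁿ ¬a) = ofⁿ (¬a ∘ from)

eqBit-reflects : ∀ b c → Reflects (b ≡ c) (eqBit b c)
eqBit-reflects false false = ofʸ refl
eqBit-reflects false true = ofⁿ λ ()
eqBit-reflects true false = ofⁿ λ ()
eqBit-reflects true true = ofʸ refl

eqBlock-reflects : ∀ {n} (u w : Vec Bool n) → Reflects (u ≡ w) (eqBlock u w)
eqBlock-reflects [] [] = ofʸ refl
eqBlock-reflects (b ∷ u) (c ∷ w) =
  map-reflects (λ (b≡c , u≡w) → cong₂ _∷_ b≡c u≡w) ∷-injective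
    (eqBit-reflects b c ×-reflects eqBlock-reflects u w)

firstDiffPos-self : ∀ {n} (u : Vec Bool n) → firstDiffPos u u ≡ 0
firstDiffPos-self [] = refl
firstDiffPos-self (b ∷ u) with eqBit b b | eqBit-reflects b b
... | false | ofⁿ b≢b = contradiction refl b≢b
... | true | _ rewrite firstDiffPos-self u = refl

firstDiffPos≡0⇒≡ : ∀ {n} (u w : Vec Bool n) → firstDiffPos u w ≡ 0 → u ≡ w
firstDiffPos≡0⇒≡ [] [] _ = refl
firstDiffPos≡0⇒≡ (b ∷ u) (c ∷ w) eq with eqBit b c | eqBit-reflects b c
... | true | ofʸ refl with firstDiffPos u w in eq′
...   | 0 = cong (b ∷_) (firstDiffPos≡0⇒≡ u w eq′)

firstDiffPos≡0⇔≡ : ∀ {n} (u w : Vec Bool n) → firstDiffPos u w ≡ 0 ⇔ u ≡ w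
firstDiffPos≡0⇔≡ u w = mk⇔ (firstDiffPos≡0⇒≡ u w) λ { refl → firstDiffPos-self u }

firstDiffBlock-nothing : ∀ {k m} (xs ys : Vec (Block m) k) → firstDiffBlock xs ys ≡ nothing → xs ≡ ys
firstDiffBlock-nothing [] [] _ = refl
firstDiffBlock-nothing (a ∷ xs) (b ∷ ys) eq with eqBlock a b | eqBlock-reflects a b
... | true | ofʸ refl with firstDiffBlock xs ys in eq′
...   | nothing = cong (a ∷_) (firstDiffBlock-nothing xs ys eq′)

firstDiffBlock-just : ∀ {k m} (xs ys : Vec (Block m) k) {i c d} →
  firstDiffBlock xs ys ≡ just (i , c , d) →
  ∃[ j ] ℕ.suc (toℕ j) ≡ i × lookup xs j ≡ c × lookup ys j ≡ d × c ≢ d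
firstDiffBlock-just [] [] ()
firstDiffBlock-just (a ∷ xs) (b ∷ ys) eq with eqBlock a b | eqBlock-reflects a b
... | false | ofⁿ a≢b with refl ← eq = zero , refl , refl , refl , a≢b
... | true | ofʸ _ with firstDiffBlock xs ys in eq′
...   | just _ with refl ← eq with j , p , q , r , s ← firstDiffBlock-just xs ys eq′ =
        suc j , cong ℕ.suc p , q , r , s

blockComponent : ∀ {m} → Color m → Maybe (ℕ × (Block m × Block m))
blockComponent = proj₁

positionComponent : ∀ {m} → Color m → Vec ℕ m
positionComponent = proj₁ ∘ proj₂

φ-orientations : ∀ {m} (x y : Vertex m) → φ x y ≡ φ< x y ⊎ φ x y ≡ φ< y x
φ-orientations x y with ltV x y
... | true = inj₁ refl
... | false = inj₂ refl

unordered-orientations : ∀ {m} (a b : Block m) → unordered a b ≡ (a , b) ⊎ unordered a b ≡ (b , a)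
unordered-orientations a b with ltBits b a
... | true = inj₂ refl
... | false = inj₁ refl

BlockPairAt : ∀ {m} → Fin m → Vertex m → Vertex m → Maybe (ℕ × (Block m × Block m)) → Set
BlockPairAt k x y p =
  p ≡ just (ℕ.suc (toℕ k) , lookup x k , lookup y k) ⊎ p ≡ just (ℕ.suc (toℕ k) , lookup y k , lookup x k)

φ<-blockComponent : ∀ {m} (x y : Vertex m) → x ≢ y →
  ∃[ k ] lookup x k ≢ lookup y k × BlockPairAt k x y (blockComponent (φ< x y))
φ<-blockComponent x y x≢y with firstDiffBlock x y in eq
... | nothing = contradiction (firstDiffBlock-nothing x y eq) x≢y
... | just (i , c , d) with k , refl , refl , refl , c≢d ← firstDiffBlock-just x y eq =
  k , c≢d , Sum.map (cong (just ∘ (i ,_))) (cong (just ∘ (i ,_))) (unordered-orientations c d)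

φ-blockComponent : ∀ {m} (x y : Vertex m) → x ≢ y →
  ∃[ k ] lookup x k ≢ lookup y k × BlockPairAt k x y (blockComponent (φ x y))
φ-blockComponent x y x≢y with φ-orientations x y
... | inj₁ eq rewrite eq = φ<-blockComponent x y x≢y
... | inj₂ eq rewrite eq with k , yₖ≢xₖ , pair ← φ<-blockComponent y x (x≢y ∘ sym) =
  k , yₖ≢xₖ ∘ sym , swap pair

φ-positionComponent : ∀ {m} (x y : Vertex m) (k : Fin m) →
  lookup (positionComponent (φ x y)) k ≡ 0 ⇔ lookup x k ≡ lookup y k
φ-positionComponent x y k with φ-orientations x y
... | inj₁ eq rewrite eq | lookup-zipWith firstDiffPos k x y =
  firstDiffPos≡0⇔≡ (lookup x k) (lookup y k)
... | inj₂ eq rewrite eq | lookup-zipWith firstDiffPos k y x =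
  mk⇔ (sym ∘ to) (from ∘ sym)
  where open Equivalence (firstDiffPos≡0⇔≡ (lookup y k) (lookup x k))

φ-respects-agreement : ∀ {m} {x y x′ y′ : Vertex m} (k : Fin m) → φ x y ≡ φ x′ y′ →
  lookup x k ≡ lookup y k → lookup x′ k ≡ lookup y′ k
φ-respects-agreement {x = x} {y} {x′} {y′} k same agree =
  Equivalence.to (φ-positionComponent x′ y′ k)
    (trans (cong (λ col → lookup (positionComponent col) k) (sym same))
           (Equivalence.from (φ-positionComponent x y k) agree))

φ-sameBlockComponent : ∀ {m} {x y x′ y′ : Vertex m} → x ≢ y → x′ ≢ y′ →
  blockComponent (φ x y) ≡ blockComponent (φ x′ y′) →
  ∃[ k ] lookup x k ≢ lookup y k ×
    ((lookup x k ≡ lookup x′ k × lookup y k ≡ lookup y′ k) ⊎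
     (lookup x k ≡ lookup y′ k × lookup y k ≡ lookup x′ k))
φ-sameBlockComponent {x = x} {y} {x′} {y′} x≢y x′≢y′ same
  with k , xₖ≢yₖ , pair ← φ-blockComponent x y x≢y
     | k′ , _ , pair′ ← φ-blockComponent x′ y′ x′≢y′
  = k , xₖ≢yₖ , match pair pair′
  where
  entries : ∀ {k′ u w u′ w′} → just (ℕ.suc (toℕ k) , u , w) ≡ just (ℕ.suc (toℕ k′) , u′ , w′) →
    k ≡ k′ × u ≡ u′ × w ≡ w′
  entries eq with i≡i′ , uw≡u′w′ ← ,-injective (just-injective eq)
    with refl ← toℕ-injective (suc-injective i≡i′) = refl , ,-injective uw≡u′w′

  match : BlockPairAt k x y (blockComponent (φ x y)) → BlockPairAt k′ x′ y′ (blockComponent (φ x′ y′)) →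
    (lookup x k ≡ lookup x′ k × lookup y k ≡ lookup y′ k) ⊎
    (lookup x k ≡ lookup y′ k × lookup y k ≡ lookup x′ k)
  match (inj₁ p) (inj₁ p′) with refl , u , w ← entries (trans (sym p) (trans same p′)) = inj₁ (u , w)
  match (inj₁ p) (inj₂ p′) with refl , u , w ← entries (trans (sym p) (trans same p′)) = inj₂ (u , w)
  match (inj₂ p) (inj₁ p′) with refl , w , u ← entries (trans (sym p) (trans same p′)) = inj₂ (u , w)
  match (inj₂ p) (inj₂ p′) with refl , w , u ← entries (trans (sym p) (trans same p′)) = inj₁ (u , w)

cons-injective : ∀ {n} {A : Set} {x : A} {f : Fin n → A} →
  Injective _≡_ _≡_ f → (∀ i → x ≢ f i) → Injective _≡_ _≡_ (x Fun.∷ f)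
cons-injective f-inj x∉f {zero} {zero} _ = refl
cons-injective f-inj x∉f {zero} {suc j} eq = contradiction eq (x∉f j)
cons-injective f-inj x∉f {suc i} {zero} eq = contradiction (sym eq) (x∉f i)
cons-injective f-inj x∉f {suc i} {suc j} eq = cong suc (f-inj eq)

outside-injective-image-unique : ∀ {n} {f : Fin n → Fin (ℕ.suc n)} {x y} →
  Injective _≡_ _≡_ f → (∀ i → x ≢ f i) → (∀ i → y ≢ f i) → x ≡ y
outside-injective-image-unique {n} {f} {x} {y} f-inj x∉f y∉f with x ≟ y
... | yes x≡y = x≡y
... | no x≢y = ⊥-elim (<⇒notInjective (n<1+n (ℕ.suc n)) (cons-injective (cons-injective f-inj x∉f) y∉x∷f))
  where
  y∉x∷f : ∀ i → y ≢ (x Fun.∷ f) i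
  y∉x∷f zero = x≢y ∘ sym
  y∉x∷f (suc i) = y∉f i

module AgreementInK₅ {C B : Set} (c : Fin 5 → Fin 5 → C) (g : Fin 5 → B)
  (c-respects-agreement : ∀ {x y x′ y′} → c x y ≡ c x′ y′ → g x ≡ g y → g x′ ≡ g y′)
  (is22222 : Is22222 c) (a b : Fin 5) (ga≢gb : g a ≢ g b)
  (paths : ∀ e₁ e₂ f₁ f₂ → e₁ < e₂ → f₁ < f₂ → (e₁ , e₂) ≢ (f₁ , f₂) →
     c e₁ e₂ ≡ c f₁ f₂ → c e₁ e₂ ≢ c a b → Share e₁ e₂ f₁ f₂) where

  agreeing-edge-extends< : ∀ {x y} → x < y → g x ≡ g y → ∃[ z ] z ≢ x × z ≢ y × g z ≡ g x
  agreeing-edge-extends< {x} {y} x<y gx≡gy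
    with p , q , p<q , pq≢xy , cpq≡cxy , _ ← is22222 x y x<y
    with gp≡gq ← c-respects-agreement (sym cpq≡cxy) gx≡gy
    with paths p q x y p<q x<y pq≢xy cpq≡cxy
           (λ cpq≡cab → ga≢gb (c-respects-agreement cpq≡cab gp≡gq))
  ... | inj₁ refl = q , (<⇒≢ p<q ∘ sym) , (λ q≡y → pq≢xy (cong (p ,_) q≡y)) , sym gp≡gq
  ... | inj₂ (inj₁ refl) = q , (<⇒≢ (<-trans x<y p<q) ∘ sym) , (<⇒≢ p<q ∘ sym) , trans (sym gp≡gq) (sym gx≡gy)
  ... | inj₂ (inj₂ (inj₁ refl)) = p , <⇒≢ p<q , <⇒≢ (<-trans p<q x<y) , gp≡gq
  ... | inj₂ (inj₂ (inj₂ refl)) = p , (λ p≡x → pq≢xy (cong (_, q) p≡x)) , <⇒≢ p<q , trans gp≡gq (sym gx≡gy)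

  agreeing-edge-extends : ∀ {x y} → x ≢ y → g x ≡ g y → ∃[ z ] z ≢ x × z ≢ y × g z ≡ g x
  agreeing-edge-extends {x} {y} x≢y gx≡gy with <-cmp x y
  ... | tri< x<y _ _ = agreeing-edge-extends< x<y gx≡gy
  ... | tri≈ _ x≡y _ = contradiction x≡y x≢y
  ... | tri> _ _ y<x with z , z≢y , z≢x , gz≡gy ← agreeing-edge-extends< y<x (sym gx≡gy) =
    z , z≢x , z≢y , trans gz≡gy (sym gx≡gy)

  no-crossing-agreement : ∀ {p q p′ q′} → Disjoint p q p′ q′ →
    g p ≡ g p′ → g q ≡ g q′ → g p ≢ g q → ⊥
  no-crossing-agreement {p} {q} {p′} {q′} (p≢p′ , p≢q′ , q≢p′ , q≢q′) gp≡gp′ gq≡gq′ gp≢gq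
    with z , z≢p , z≢p′ , gz≡gp ← agreeing-edge-extends p≢p′ gp≡gp′
       | z′ , z′≢q , z′≢q′ , gz′≡gq ← agreeing-edge-extends q≢q′ gq≡gq′
    = gp≢gq (trans (sym gz≡gp) (trans (cong g z≡z′) gz′≡gq))
    where
    p≢q : p ≢ q
    p≢q = gp≢gq ∘ cong g

    p′≢q′ : p′ ≢ q′
    p′≢q′ p′≡q′ = gp≢gq (trans gp≡gp′ (trans (cong g p′≡q′) (sym gq≡gq′)))

    pp′qq′ : Fin 4 → Fin 5
    pp′qq′ = p Fun.∷ p′ Fun.∷ q Fun.∷ q′ Fun.∷ Fun.[]

    pp′qq′-injective : Injective _≡_ _≡_ pp′qq′
    pp′qq′-injective =
      cons-injective (cons-injective (cons-injective (cons-injective (λ { {()} }) λ ())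
        λ { zero → q≢q′ ; (suc ()) })
        λ { zero → q≢p′ ∘ sym ; (suc zero) → p′≢q′ ; (suc (suc ())) })
        λ { zero → p≢p′ ; (suc zero) → p≢q ; (suc (suc zero)) → p≢q′ ; (suc (suc (suc ()))) }

    -- z and z′ both avoid the four distinct vertices p, p′, q, q′, so both are the fifth vertex.
    z≡z′ : z ≡ z′
    z≡z′ = outside-injective-image-unique pp′qq′-injective
      (λ { zero → z≢p ; (suc zero) → z≢p′
         ; (suc (suc zero)) → λ z≡q → gp≢gq (trans (sym gz≡gp) (cong g z≡q))
         ; (suc (suc (suc zero))) → λ z≡q′ → gp≢gq (trans (sym gz≡gp) (trans (cong g z≡q′) (sym gq≡gq′))) })
      (λ { zero → λ z′≡p → gp≢gq (trans (sym (cong g z′≡p)) gz′≡gq)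
         ; (suc zero) → λ z′≡p′ → gp≢gq (trans gp≡gp′ (trans (sym (cong g z′≡p′)) gz′≡gq))
         ; (suc (suc zero)) → z′≢q ; (suc (suc (suc zero))) → z′≢q′ })

  no-matching-agreement : ∀ {a′ b′} → Disjoint a b a′ b′ →
    ¬ ((g a ≡ g a′ × g b ≡ g b′) ⊎ (g a ≡ g b′ × g b ≡ g a′))
  no-matching-agreement disjoint (inj₁ (ga≡ga′ , gb≡gb′)) =
    no-crossing-agreement disjoint ga≡ga′ gb≡gb′ ga≢gb
  no-matching-agreement (a≢a′ , a≢b′ , b≢a′ , b≢b′) (inj₂ (ga≡gb′ , gb≡ga′)) =
    no-crossing-agreement (a≢b′ , a≢a′ , b≢b′ , b≢a′) ga≡gb′ gb≡ga′ ga≢gb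

lemma14 : (m : ℕ) → m ≥ 1 → (v : Fin 5 → Vertex m) → Injective _≡_ _≡_ v →
    ¬ OneMatchingFourPaths (λ a b → φ (v a) (v b))
lemma14 m _ v v-injective (is22222 , a , b , a′ , b′ , a<b , a′<b′ , same-colour , disjoint , paths)
  with k , aₖ≢bₖ , blocks-match ← φ-sameBlockComponent (<⇒≢ a<b ∘ v-injective) (<⇒≢ a′<b′ ∘ v-injective)
                                     (cong blockComponent same-colour)
  = AgreementInK₅.no-matching-agreement (λ x y → φ (v x) (v y)) (λ x → lookup (v x) k)
      (φ-respects-agreement k) is22222 a b aₖ≢bₖ paths disjoint blocks-match
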